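{- Let $n\ge3$ be an integer, ${\mathrm T}_m=\binom{m+1}{2}$, and ${\mathcal T}_n=\langle {\mathrm T}_n,{\mathrm T}_{n+1},{\mathrm T}_{n+2}\rangle$, with its minimal system of generators taken in the arrangement $(n_1,n_2,n_3)=({\mathrm T}_n,{\mathrm T}_{n+1},{\mathrm T}_{n+2})$. Then: (1) if $n$ is odd, $c^*_2=n$ and $c^*_3=\frac{n+1}{2}$; (2) if $n$ is even, $c^*_2=\frac{n}{2}$ and $c^*_3=n+1$.
   Context: $\langle a_1,\ldots,a_k\rangle$ denotes the set of non-negative integer linear combinations of $a_1,\ldots,a_k$. For a numerical semigroup with minimal system of generators arranged as $(n_1,\ldots,n_e)$, and $i\in\{2,\ldots,e\}$, $c^*_i=\min\{k\in\mathbb N,\ k\ge1 \mid k n_i\in\langle n_1,\ldots,n_{i-1}\rangle\}$. For $n\ge3$, $\{{\mathrm T}_n,{\mathrm T}_{n+1},{\mathrm T}_{n+2}\}$ is the minimal system of generators of ${\mathcal T}_n$. -}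

module Defs where

open import Data.Nat using (ℕ; zero; suc; _+_; _*_; _≤_; _<_)
open import Data.Nat.Combinatorics using (_C_)
open import Data.List using (List; []; _∷_; take; length; lookup)
open import Data.Fin using (Fin)
open import Data.Product using (Σ; ∃; _×_)
open import Relation.Binary.PropositionalEquality using (_≡_)
open import Relation.Nullary using (¬_)

T : ℕ → ℕ
T m = suc m C 2

-- Linear combination of a list of generators with given coefficients
-- (coefficient list is zipped; extra entries on either side are ignored,
--  but membership quantifies over coefficient lists of exactly the right length)
lincomb : List ℕ → List ℕ → ℕ
lincomb []       _        = 0
lincomb (_ ∷ _)  []       = 0
lincomb (g ∷ gs) (c ∷ cs) = c * g + lincomb gs cs

InSemigroup : List ℕ → ℕ → Set
InSemigroup gs x = Σ (List ℕ) λ cs → (length cs ≡ length gs) × (lincomb gs cs ≡ x)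

-- c*_i for the arrangement gs = (n₁,…,n_e); i is 1-based, 2 ≤ i ≤ e.
-- IsCStar gs i k  :  k is the minimum of { k ≥ 1 | k·n_i ∈ ⟨n₁,…,n_{i-1}⟩ }.
IsCStar : (gs : List ℕ) → (i : Fin (length gs)) → ℕ → Set
IsCStar gs i k =
  (1 ≤ k) × InSemigroup (take (Data.Fin.toℕ i) gs) (k * lookup gs i)
  × (∀ j → 1 ≤ j → j < k → ¬ InSemigroup (take (Data.Fin.toℕ i) gs) (j * lookup gs i))

gensT : ℕ → List ℕ
gensT n = T n ∷ T (suc n) ∷ T (suc (suc n)) ∷ []

module Submission where

-- For n = 2m + 1 the generators are (m+1)(2m+1), (m+1)(2m+3), (m+2)(2m+3); for n = 2m they are
-- (2m+1)m, (2m+1)(m+1), (m+1)(2m+3).  In both cases n₁ = c x and n₂ = c y with x, y coprime, so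
-- k n₂ ∈ ⟨n₁⟩ forces x ∣ k; and n₁, n₂ are multiples of some d with n₃ ≡ 1 (mod d), so
-- k n₃ ∈ ⟨n₁, n₂⟩ forces d ∣ k.  The relations y n₁ = x n₂ and d n₃ = e n₂ show both bounds are attained.

open import Defs
open import Data.Nat using (ℕ; zero; suc; _+_; _*_; _≤_; _<_; s≤s; z≤n; >-nonZero)
open import Data.Nat.Properties using (*-distribˡ-+; *-cancelˡ-≡; <⇒≱; m≤n+m)
open import Data.Nat.Combinatorics using (nCk+nC[k+1]≡[n+1]C[k+1]; nC1≡n)
open import Data.Nat.Divisibility
  using (_∣_; _∣0; ∣-refl; ∣-trans; ∣⇒≤; ∣1⇒≡1; ∣m∣n⇒∣m+n; ∣m+n∣m⇒∣n; m∣m*n; n∣m*n; *-cancelˡ-∣)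
open import Data.Nat.Coprimality using (Coprime; coprime-divisor)
open import Data.Nat.Tactic.RingSolver using (solve)
open import Data.Fin using (zero; suc; toℕ)
open import Data.List using ([]; _∷_; take; lookup)
open import Data.List.Relation.Unary.All as All using (All)
open import Data.Product using (_×_; _,_)
open import Relation.Binary.PropositionalEquality
  using (_≡_; refl; sym; trans; cong; subst; module ≡-Reasoning)

T-suc : ∀ m → T (suc m) ≡ suc m + T m
T-suc m = trans (sym (nCk+nC[k+1]≡[n+1]C[k+1] (suc m) 1)) (cong (_+ T m) (nC1≡n (suc m)))

2*T[m]≡m*[1+m] : ∀ m → 2 * T m ≡ m * suc m
2*T[m]≡m*[1+m] zero    = refl
2*T[m]≡m*[1+m] (suc m) = begin
  2 * T (suc m)          ≡⟨ cong (2 *_) (T-suc m) ⟩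
  2 * (suc m + T m)      ≡⟨ *-distribˡ-+ 2 (suc m) (T m) ⟩
  2 * suc m + 2 * T m    ≡⟨ cong (2 * suc m +_) (2*T[m]≡m*[1+m] m) ⟩
  2 * suc m + m * suc m  ≡⟨ solve (m ∷ []) ⟩
  suc m * suc (suc m)    ∎
  where open ≡-Reasoning

m*[1+m]≡2*e⇒T[m]≡e : ∀ m {e} → m * suc m ≡ 2 * e → T m ≡ e
m*[1+m]≡2*e⇒T[m]≡e m {e} eq = *-cancelˡ-≡ (T m) e 2 (trans (2*T[m]≡m*[1+m] m) eq)

lincomb-∣ : ∀ {d} gs cs → All (d ∣_) gs → d ∣ lincomb gs cs
lincomb-∣ []       _        _              = _ ∣0
lincomb-∣ (_ ∷ _)  []       _              = _ ∣0
lincomb-∣ (g ∷ gs) (c ∷ cs) (d∣g All.∷ ds) = ∣m∣n⇒∣m+n (∣-trans d∣g (n∣m*n c)) (lincomb-∣ gs cs ds)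

InSemigroup-∣ : ∀ {d gs x} → All (d ∣_) gs → InSemigroup gs x → d ∣ x
InSemigroup-∣ {gs = gs} ds (cs , _ , refl) = lincomb-∣ gs cs ds

IsCStar-by-divisibility : ∀ gs i {d} → 1 ≤ d →
  InSemigroup (take (toℕ i) gs) (d * lookup gs i) →
  (∀ k → InSemigroup (take (toℕ i) gs) (k * lookup gs i) → d ∣ k) →
  IsCStar gs i d
IsCStar-by-divisibility gs i 1≤d d∈S d∣ =
  1≤d , d∈S , λ j 1≤j j<d j∈S → <⇒≱ j<d (∣⇒≤ {{>-nonZero 1≤j}} (d∣ j j∈S))

Bézout⇒coprime : ∀ {m n} u v → u * m + 1 ≡ v * n → Coprime m n
Bézout⇒coprime u v eq {i} (i∣m , i∣n) =
  ∣1⇒≡1 (∣m+n∣m⇒∣n (subst (i ∣_) (sym eq) (∣-trans i∣n (n∣m*n v))) (∣-trans i∣m (n∣m*n u)))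

IsCStar₂-coprime : ∀ {n₁ n₂} c x y zs → 1 ≤ c → 1 ≤ x → Coprime x y →
  n₁ ≡ c * x → n₂ ≡ c * y → IsCStar (n₁ ∷ n₂ ∷ zs) (suc zero) x
IsCStar₂-coprime c x y zs 1≤c 1≤x x⊥y refl refl =
  IsCStar-by-divisibility (c * x ∷ c * y ∷ zs) (suc zero) 1≤x (y ∷ [] , refl , witness) x∣
  where
  witness : y * (c * x) + 0 ≡ x * (c * y)
  witness = solve (c ∷ x ∷ y ∷ [])
  x∣ : ∀ k → InSemigroup (c * x ∷ []) (k * (c * y)) → x ∣ k
  x∣ k k∈S = coprime-divisor x⊥y (*-cancelˡ-∣ c {{>-nonZero 1≤c}} cx∣c[yk])
    where
    reassoc : k * (c * y) ≡ c * (y * k)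
    reassoc = solve (k ∷ c ∷ y ∷ [])
    cx∣c[yk] : c * x ∣ c * (y * k)
    cx∣c[yk] = subst (c * x ∣_) reassoc (InSemigroup-∣ (∣-refl All.∷ All.[]) k∈S)

IsCStar₃-unit : ∀ {n₁ n₂ n₃} d q x y zs → 1 ≤ d →
  n₁ ≡ d * x → n₂ ≡ d * y → n₃ ≡ q * d + 1 → InSemigroup (n₁ ∷ n₂ ∷ []) (d * n₃) →
  IsCStar (n₁ ∷ n₂ ∷ n₃ ∷ zs) (suc (suc zero)) d
IsCStar₃-unit d q x y zs 1≤d refl refl refl d∈S =
  IsCStar-by-divisibility (d * x ∷ d * y ∷ q * d + 1 ∷ zs) (suc (suc zero)) 1≤d d∈S d∣
  where
  d∣ : ∀ k → InSemigroup (d * x ∷ d * y ∷ []) (k * (q * d + 1)) → d ∣ k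
  d∣ k k∈S = ∣m+n∣m⇒∣n (subst (d ∣_) expand d∣k[qd+1]) (n∣m*n (k * q))
    where
    expand : k * (q * d + 1) ≡ k * q * d + k
    expand = solve (k ∷ q ∷ d ∷ [])
    d∣k[qd+1] : d ∣ k * (q * d + 1)
    d∣k[qd+1] = InSemigroup-∣ (m∣m*n x All.∷ m∣m*n y All.∷ All.[]) k∈S

IsCStar-gensT-odd : ∀ {n} m → n ≡ 2 * m + 1 →
  IsCStar (gensT n) (suc zero) n × IsCStar (gensT n) (suc (suc zero)) (m + 1)
IsCStar-gensT-odd m refl =
    IsCStar₂-coprime (m + 1) (2 * m + 1) (2 * m + 3) (T (suc (suc (2 * m + 1))) ∷ [])
      (m≤n+m 1 m) (m≤n+m 1 (2 * m)) coprime Tₙ Tₙ₊₁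
  , IsCStar₃-unit (m + 1) (2 * m + 5) (2 * m + 1) (2 * m + 3) [] (m≤n+m 1 m)
      Tₙ Tₙ₊₁ Tₙ₊₂ (0 ∷ m + 2 ∷ [] , refl , witness)
  where
  coprime : Coprime (2 * m + 1) (2 * m + 3)
  coprime = Bézout⇒coprime {2 * m + 1} {2 * m + 3} (m + 2) (m + 1) (solve (m ∷ []))
  Tₙ : T (2 * m + 1) ≡ (m + 1) * (2 * m + 1)
  Tₙ = m*[1+m]≡2*e⇒T[m]≡e (2 * m + 1) (solve (m ∷ []))
  Tₙ₊₁ : T (suc (2 * m + 1)) ≡ (m + 1) * (2 * m + 3)
  Tₙ₊₁ = m*[1+m]≡2*e⇒T[m]≡e (suc (2 * m + 1)) (solve (m ∷ []))
  Tₙ₊₂ : T (suc (suc (2 * m + 1))) ≡ (2 * m + 5) * (m + 1) + 1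
  Tₙ₊₂ = m*[1+m]≡2*e⇒T[m]≡e (suc (suc (2 * m + 1))) (solve (m ∷ []))
  witness : (m + 2) * T (suc (2 * m + 1)) + 0 ≡ (m + 1) * T (suc (suc (2 * m + 1)))
  witness = begin
    (m + 2) * T (suc (2 * m + 1)) + 0      ≡⟨ cong (λ t → (m + 2) * t + 0) Tₙ₊₁ ⟩
    (m + 2) * ((m + 1) * (2 * m + 3)) + 0  ≡⟨ solve (m ∷ []) ⟩
    (m + 1) * ((2 * m + 5) * (m + 1) + 1)  ≡⟨ cong ((m + 1) *_) Tₙ₊₂ ⟨
    (m + 1) * T (suc (suc (2 * m + 1)))    ∎
    where open ≡-Reasoning

IsCStar-gensT-even : ∀ {n} m → 1 ≤ m → n ≡ 2 * m →
  IsCStar (gensT n) (suc zero) m × IsCStar (gensT n) (suc (suc zero)) (n + 1)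
IsCStar-gensT-even m 1≤m refl =
    IsCStar₂-coprime (2 * m + 1) m (m + 1) (T (suc (suc (2 * m))) ∷ [])
      (m≤n+m 1 (2 * m)) 1≤m coprime Tₙ Tₙ₊₁
  , IsCStar₃-unit (2 * m + 1) (m + 2) m (m + 1) [] (m≤n+m 1 (2 * m))
      Tₙ Tₙ₊₁ Tₙ₊₂ (0 ∷ 2 * m + 3 ∷ [] , refl , witness)
  where
  coprime : Coprime m (m + 1)
  coprime = Bézout⇒coprime {m} {m + 1} 1 1 (solve (m ∷ []))
  Tₙ : T (2 * m) ≡ (2 * m + 1) * m
  Tₙ = m*[1+m]≡2*e⇒T[m]≡e (2 * m) (solve (m ∷ []))
  Tₙ₊₁ : T (suc (2 * m)) ≡ (2 * m + 1) * (m + 1)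
  Tₙ₊₁ = m*[1+m]≡2*e⇒T[m]≡e (suc (2 * m)) (solve (m ∷ []))
  Tₙ₊₂ : T (suc (suc (2 * m))) ≡ (m + 2) * (2 * m + 1) + 1
  Tₙ₊₂ = m*[1+m]≡2*e⇒T[m]≡e (suc (suc (2 * m))) (solve (m ∷ []))
  witness : (2 * m + 3) * T (suc (2 * m)) + 0 ≡ (2 * m + 1) * T (suc (suc (2 * m)))
  witness = begin
    (2 * m + 3) * T (suc (2 * m)) + 0          ≡⟨ cong (λ t → (2 * m + 3) * t + 0) Tₙ₊₁ ⟩
    (2 * m + 3) * ((2 * m + 1) * (m + 1)) + 0  ≡⟨ solve (m ∷ []) ⟩
    (2 * m + 1) * ((m + 2) * (2 * m + 1) + 1)  ≡⟨ cong ((2 * m + 1) *_) Tₙ₊₂ ⟨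
    (2 * m + 1) * T (suc (suc (2 * m)))        ∎
    where open ≡-Reasoning

half-positive : ∀ {n} m → 3 ≤ n → n ≡ 2 * m → 1 ≤ m
half-positive zero    () refl
half-positive (suc m) _  _ = s≤s z≤n

lemma22 : (n : ℕ) → 3 ≤ n →
            (∀ m → n ≡ 2 * m + 1 → IsCStar (gensT n) (suc zero) n × IsCStar (gensT n) (suc (suc zero)) (m + 1))
            × (∀ m → n ≡ 2 * m → IsCStar (gensT n) (suc zero) m × IsCStar (gensT n) (suc (suc zero)) (n + 1))
lemma22 n 3≤n = IsCStar-gensT-odd , λ m n≡2m → IsCStar-gensT-even m (half-positive m 3≤n n≡2m) n≡2m
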